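{- Let $G$ be a graph with vertex set $\{v_1,\dots,v_n\}$, and let $v_1,\dots,v_r$ ($r\ge 2$) be vertices having the same closed neighbourhood, i.e. $N[v_1]=N[v_2]=\cdots=N[v_r]$. For some $t$ with $1\le t\le r-1$, let $G^\sigma$ be the switching of $G$ about $\{v_1,\dots,v_t\}$. Then $G^\sigma$ has at least $r-1$ linearly independent main eigenvectors for the eigenvalue $-1$.
   Context: $N[u]=N(u)\cup\{u\}$ is the closed neighbourhood of $u$. The switching of $G$ about $X\subseteq V(G)$ is the signed graph whose adjacency matrix is $PA(G)P$, where $P$ is diagonal with $p_{ii}=-1$ if $v_i\in X$ and $1$ otherwise (edges between $X$ and its complement become negative). A main eigenvector is an eigenvector whose entries have nonzero sum. -}

module Defs where

open import Data.Nat using (ℕ; zero; suc; _<_; _<ᵇ_)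
open import Data.Fin using (Fin; toℕ; _≟_)
open import Data.Bool using (Bool; true; false; if_then_else_; _∨_)
open import Data.Rational using (ℚ; 0ℚ; 1ℚ; _+_; _*_; -_)
open import Data.Product using (Σ; ∃; _×_)
open import Relation.Binary.PropositionalEquality using (_≡_; _≢_)
open import Relation.Nullary using (¬_)
open import Relation.Nullary.Decidable using (⌊_⌋)

-- A finite simple graph on vertex set Fin n (vertex v_i is the index i-1).
record Graph (n : ℕ) : Set where
  field
    adj     : Fin n → Fin n → Bool
    sym     : ∀ u v → adj u v ≡ adj v u
    irrefl  : ∀ u → adj u u ≡ false
open Graph public

closedNbhd : ∀ {n} → Graph n → Fin n → Fin n → Bool
closedNbhd G u w = ⌊ u ≟ w ⌋ ∨ adj G u w

Σℚ : ∀ {n} → (Fin n → ℚ) → ℚ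
Σℚ {zero}  f = 0ℚ
Σℚ {suc n} f = f Fin.zero + Σℚ (λ i → f (Fin.suc i))
  where import Data.Fin as Fin

adjMat : ∀ {n} → Graph n → Fin n → Fin n → ℚ
adjMat G u v = if adj G u v then 1ℚ else 0ℚ

-- switching sign p_ii: -1 if v ∈ X = {v_1,…,v_t} (i.e. index < t), else 1
switchSign : ∀ {n} → ℕ → Fin n → ℚ
switchSign t v = if toℕ v <ᵇ t then - 1ℚ else 1ℚ

-- adjacency matrix P A(G) P of the switching of G about {v_1,…,v_t}
switchedAdj : ∀ {n} → Graph n → ℕ → Fin n → Fin n → ℚ
switchedAdj G t u v = switchSign t u * adjMat G u v * switchSign t v

IsEigenvector : ∀ {n} → (Fin n → Fin n → ℚ) → ℚ → (Fin n → ℚ) → Set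
IsEigenvector M λ' x =
  (∃ λ w → x w ≢ 0ℚ) × (∀ u → Σℚ (λ w → M u w * x w) ≡ λ' * x u)

IsMain : ∀ {n} → (Fin n → ℚ) → Set
IsMain x = Σℚ x ≢ 0ℚ

LinearlyIndependent : ∀ {k n} → (Fin k → Fin n → ℚ) → Set
LinearlyIndependent {k} x =
  ∀ (c : Fin k → ℚ) → (∀ w → Σℚ (λ i → c i * x i w) ≡ 0ℚ) → ∀ i → c i ≡ 0ℚ

{-# OPTIONS --safe #-}
module Submission where

-- If a and b are twins (equal closed neighbourhoods, hence adjacent) on opposite sides of the
-- switching, then e_a + e_b is a main eigenvector of the switched matrix for -1: in a row
-- u ∉ {a, b} the entries at a and b cancel, since u sees a and b alike but they carry opposite
-- signs, while rows a and b only see the negative edge ab. As v_1 is switched and v_r is not,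
-- pairing each of v_2, …, v_r with v_r or v_1 according to its own side gives r - 1 such
-- vectors. The one pairing v_k vanishes at v_2, …, v_(k-1), so the family is unitriangular,
-- hence linearly independent.

open import Defs renaming (sym to adj-sym)
open import Data.Nat using (ℕ; _≤_; _∸_; zero; suc; s≤s; z≤n; _<ᵇ_)
open import Data.Nat.Properties using (<ᵇ⇒<; <⇒≱; ≤⇒≯)
open import Data.Fin using (Fin; inject≤; toℕ; fromℕ; _≟_) renaming (_<_ to _<ᶠ_)
import Data.Fin as Fin
open import Data.Fin.Properties
  using (suc-injective; <⇒≢; punchInᵢ≢i; inject≤-injective; toℕ-inject≤; toℕ-fromℕ; ≤fromℕ)
open import Data.Rational using (ℚ; 0ℚ; 1ℚ; -_; _+_; _*_)
open import Data.Rational.Properties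
  using (+-0-commutativeMonoid; +-identityˡ; +-identityʳ; *-identityʳ; *-zeroˡ; *-zeroʳ; *-distribˡ-+)
open import Algebra.Properties.CommutativeMonoid.Sum +-0-commutativeMonoid
  using (sum; sum-cong-≗; ∑-distrib-+; sum-remove; sum-replicate-zero)
open import Data.Vec.Functional using (removeAt; replicate)
open import Data.Bool using (Bool; true; false; T; if_then_else_; _∨_)
open import Data.Product using (Σ; _×_; _,_)
open import Data.Unit using (tt)
open import Function using (_∘_; Injective)
open import Relation.Nullary using (does; yes; no; contradiction)
open import Relation.Nullary.Decidable using (isYes≗does; dec-true; dec-false)
open import Relation.Binary.PropositionalEquality

Σℚ≡sum : ∀ {n} (f : Fin n → ℚ) → Σℚ f ≡ sum f
Σℚ≡sum {zero}  f = refl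
Σℚ≡sum {suc n} f = cong (f Fin.zero +_) (Σℚ≡sum (f ∘ Fin.suc))

sum-supported : ∀ {n} (f : Fin n → ℚ) (i : Fin n) → (∀ j → j ≢ i → f j ≡ 0ℚ) → sum f ≡ f i
sum-supported {suc n} f i vanish = begin
  sum f                      ≡⟨ sum-remove {i = i} f ⟩
  f i + sum (removeAt f i)   ≡⟨ cong (f i +_) (sum-cong-≗ λ j → vanish (Fin.punchIn i j) (punchInᵢ≢i i j)) ⟩
  f i + sum (replicate n 0ℚ) ≡⟨ cong (f i +_) (sum-replicate-zero n) ⟩
  f i + 0ℚ                   ≡⟨ +-identityʳ (f i) ⟩
  f i                        ∎
  where open ≡-Reasoning

unitVec : ∀ {n} → Fin n → Fin n → ℚ
unitVec i j = if does (i ≟ j) then 1ℚ else 0ℚ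

unitVec-≡ : ∀ {n} (i : Fin n) → unitVec i i ≡ 1ℚ
unitVec-≡ i = cong (if_then 1ℚ else 0ℚ) (dec-true (i ≟ i) refl)

unitVec-≢ : ∀ {n} {i j : Fin n} → i ≢ j → unitVec i j ≡ 0ℚ
unitVec-≢ {i = i} {j} i≢j = cong (if_then 1ℚ else 0ℚ) (dec-false (i ≟ j) i≢j)

sum-*-unitVec : ∀ {n} (f : Fin n → ℚ) (i : Fin n) → sum (λ j → f j * unitVec i j) ≡ f i
sum-*-unitVec f i = begin
  sum (λ j → f j * unitVec i j) ≡⟨ sum-supported _ i vanish ⟩
  f i * unitVec i i             ≡⟨ cong (f i *_) (unitVec-≡ i) ⟩
  f i * 1ℚ                      ≡⟨ *-identityʳ (f i) ⟩
  f i                           ∎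
  where
  open ≡-Reasoning
  vanish : ∀ j → j ≢ i → f j * unitVec i j ≡ 0ℚ
  vanish j j≢i = trans (cong (f j *_) (unitVec-≢ (j≢i ∘ sym))) (*-zeroʳ (f j))

twinVector : ∀ {n} → Fin n → Fin n → Fin n → ℚ
twinVector a b w = unitVec a w + unitVec b w

sum-*-twinVector : ∀ {n} (f : Fin n → ℚ) (a b : Fin n) →
  Σℚ (λ w → f w * twinVector a b w) ≡ f a + f b
sum-*-twinVector f a b = begin
  Σℚ (λ w → f w * twinVector a b w)
    ≡⟨ Σℚ≡sum (λ w → f w * twinVector a b w) ⟩
  sum (λ w → f w * twinVector a b w)
    ≡⟨ sum-cong-≗ (λ w → *-distribˡ-+ (f w) (unitVec a w) (unitVec b w)) ⟩
  sum (λ w → f w * unitVec a w + f w * unitVec b w)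
    ≡⟨ ∑-distrib-+ (λ w → f w * unitVec a w) (λ w → f w * unitVec b w) ⟩
  sum (λ w → f w * unitVec a w) + sum (λ w → f w * unitVec b w)
    ≡⟨ cong₂ _+_ (sum-*-unitVec f a) (sum-*-unitVec f b) ⟩
  f a + f b
    ∎
  where open ≡-Reasoning

sum-unitVec : ∀ {n} (i : Fin n) → sum (unitVec i) ≡ 1ℚ
sum-unitVec i = trans (sum-supported (unitVec i) i (λ j j≢i → unitVec-≢ (j≢i ∘ sym))) (unitVec-≡ i)

Σℚ-twinVector : ∀ {n} (a b : Fin n) → Σℚ (twinVector a b) ≡ 1ℚ + 1ℚ
Σℚ-twinVector a b = begin
  Σℚ (twinVector a b)               ≡⟨ Σℚ≡sum (twinVector a b) ⟩
  sum (twinVector a b)              ≡⟨ ∑-distrib-+ (unitVec a) (unitVec b) ⟩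
  sum (unitVec a) + sum (unitVec b) ≡⟨ cong₂ _+_ (sum-unitVec a) (sum-unitVec b) ⟩
  1ℚ + 1ℚ                           ∎
  where open ≡-Reasoning

twinVector-main : ∀ {n} (a b : Fin n) → IsMain (twinVector a b)
twinVector-main a b sum≡0 with trans (sym (Σℚ-twinVector a b)) sum≡0
... | ()

twinVector-outside : ∀ {n} {a b w : Fin n} → a ≢ w → b ≢ w → twinVector a b w ≡ 0ℚ
twinVector-outside a≢w b≢w = cong₂ _+_ (unitVec-≢ a≢w) (unitVec-≢ b≢w)

twinVector-fst : ∀ {n} {a b : Fin n} → a ≢ b → twinVector a b a ≡ 1ℚ
twinVector-fst {a = a} a≢b = cong₂ _+_ (unitVec-≡ a) (unitVec-≢ (a≢b ∘ sym))

twinVector-snd : ∀ {n} {a b : Fin n} → a ≢ b → twinVector a b b ≡ 1ℚ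
twinVector-snd {b = b} a≢b = cong₂ _+_ (unitVec-≢ a≢b) (unitVec-≡ b)

Twins : ∀ {n} → Graph n → Fin n → Fin n → Set
Twins G a b = ∀ w → closedNbhd G a w ≡ closedNbhd G b w

closedNbhd-self : ∀ {n} (G : Graph n) (u : Fin n) → closedNbhd G u u ≡ true
closedNbhd-self G u = cong (_∨ adj G u u) (trans (isYes≗does (u ≟ u)) (dec-true (u ≟ u) refl))

closedNbhd-≢ : ∀ {n} (G : Graph n) {u w : Fin n} → u ≢ w → closedNbhd G u w ≡ adj G u w
closedNbhd-≢ G {u} {w} u≢w = cong (_∨ adj G u w) (trans (isYes≗does (u ≟ w)) (dec-false (u ≟ w) u≢w))

twins-adjacent : ∀ {n} (G : Graph n) {a b : Fin n} → a ≢ b → Twins G a b → adj G a b ≡ true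
twins-adjacent G a≢b twins = trans (sym (closedNbhd-≢ G a≢b)) (trans (twins _) (closedNbhd-self G _))

twins-same-neighbour : ∀ {n} (G : Graph n) {a b u : Fin n} → Twins G a b → a ≢ u → b ≢ u →
  adj G u a ≡ adj G u b
twins-same-neighbour G {a} {b} {u} twins a≢u b≢u = begin
  adj G u a          ≡⟨ adj-sym G u a ⟩
  adj G a u          ≡⟨ closedNbhd-≢ G a≢u ⟨
  closedNbhd G a u   ≡⟨ twins u ⟩
  closedNbhd G b u   ≡⟨ closedNbhd-≢ G b≢u ⟩
  adj G b u          ≡⟨ adj-sym G b u ⟩
  adj G u b          ∎
  where open ≡-Reasoning

q*-1+q*1≡0 : ∀ q → q * - 1ℚ + q * 1ℚ ≡ 0ℚ
q*-1+q*1≡0 q = trans (sym (*-distribˡ-+ q (- 1ℚ) 1ℚ)) (*-zeroʳ q)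

oppositeSigns⇒≢ : ∀ {n} (t : ℕ) {a b : Fin n} → switchSign t a ≡ - 1ℚ → switchSign t b ≡ 1ℚ → a ≢ b
oppositeSigns⇒≢ t a-switched b-unswitched refl with trans (sym a-switched) b-unswitched
... | ()

module _ {n} (G : Graph n) (t : ℕ) {a b : Fin n} (twins : Twins G a b)
         (a-switched : switchSign t a ≡ - 1ℚ) (b-unswitched : switchSign t b ≡ 1ℚ) where

  private
    a≢b : a ≢ b
    a≢b = oppositeSigns⇒≢ t a-switched b-unswitched

  switchedAdj-twinVector : ∀ u → switchedAdj G t u a + switchedAdj G t u b ≡ - 1ℚ * twinVector a b u
  switchedAdj-twinVector u with u ≟ a | u ≟ b
  ... | yes refl | _
    rewrite twinVector-fst a≢b | a-switched | b-unswitched | irrefl G a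
          | twins-adjacent G a≢b twins = refl
  ... | no _ | yes refl
    rewrite twinVector-snd a≢b | a-switched | b-unswitched | irrefl G b
          | adj-sym G b a | twins-adjacent G a≢b twins = refl
  ... | no u≢a | no u≢b
    rewrite twinVector-outside (≢-sym u≢a) (≢-sym u≢b) | a-switched | b-unswitched
          | twins-same-neighbour G twins (≢-sym u≢a) (≢-sym u≢b)
    = q*-1+q*1≡0 (switchSign t u * adjMat G u b)

  twinVector-eigenvector : IsEigenvector (switchedAdj G t) (- 1ℚ) (twinVector a b)
  twinVector-eigenvector = (a , twinVector-at-a≢0) , λ u →
    trans (sum-*-twinVector (switchedAdj G t u) a b) (switchedAdj-twinVector u)
    where
    twinVector-at-a≢0 : twinVector a b a ≢ 0ℚ
    twinVector-at-a≢0 x≡0 with trans (sym (twinVector-fst a≢b)) x≡0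
    ... | ()

unitriangular⇒linearlyIndependent : ∀ {k n} (x : Fin k → Fin n → ℚ) (pivot : Fin k → Fin n) →
  (∀ i → x i (pivot i) ≡ 1ℚ) → (∀ {i j} → i <ᶠ j → x j (pivot i) ≡ 0ℚ) →
  LinearlyIndependent x
unitriangular⇒linearlyIndependent {zero}  x pivot diag upper c combo ()
unitriangular⇒linearlyIndependent {suc k} x pivot diag upper c combo = λ where
    Fin.zero    → c₀≡0
    (Fin.suc i) → unitriangular⇒linearlyIndependent (x ∘ Fin.suc) (pivot ∘ Fin.suc)
                    (diag ∘ Fin.suc) (upper ∘ s≤s) (c ∘ Fin.suc) tail-combo i
  where
  open ≡-Reasoning
  vanish : ∀ j → j ≢ Fin.zero → c j * x j (pivot Fin.zero) ≡ 0ℚ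
  vanish Fin.zero    0≢0 = contradiction refl 0≢0
  vanish (Fin.suc j) _   = trans (cong (c (Fin.suc j) *_) (upper (s≤s z≤n))) (*-zeroʳ (c (Fin.suc j)))
  c₀≡0 : c Fin.zero ≡ 0ℚ
  c₀≡0 = begin
    c Fin.zero                                     ≡⟨ *-identityʳ (c Fin.zero) ⟨
    c Fin.zero * 1ℚ                                ≡⟨ cong (c Fin.zero *_) (diag Fin.zero) ⟨
    c Fin.zero * x Fin.zero (pivot Fin.zero)       ≡⟨ sum-supported _ Fin.zero vanish ⟨
    sum (λ j → c j * x j (pivot Fin.zero))         ≡⟨ Σℚ≡sum (λ j → c j * x j (pivot Fin.zero)) ⟨
    Σℚ (λ j → c j * x j (pivot Fin.zero))          ≡⟨ combo (pivot Fin.zero) ⟩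
    0ℚ                                             ∎
  tail-combo : ∀ w → Σℚ (λ i → c (Fin.suc i) * x (Fin.suc i) w) ≡ 0ℚ
  tail-combo w = begin
    rest                                   ≡⟨ +-identityˡ rest ⟨
    0ℚ + rest                              ≡⟨ cong (_+ rest) (*-zeroˡ (x Fin.zero w)) ⟨
    0ℚ * x Fin.zero w + rest               ≡⟨ cong (λ c₀ → c₀ * x Fin.zero w + rest) c₀≡0 ⟨
    c Fin.zero * x Fin.zero w + rest       ≡⟨ combo w ⟩
    0ℚ                                     ∎
    where rest = Σℚ (λ i → c (Fin.suc i) * x (Fin.suc i) w)

fromℕ≢-below : ∀ {m} {i j : Fin (suc m)} → i <ᶠ j → fromℕ m ≢ i
fromℕ≢-below {j = j} i<j refl = <⇒≱ i<j (≤fromℕ j)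

module TwinClass {n m} (G : Graph n) (t : ℕ) (v : Fin (suc (suc m)) → Fin n)
         (v-injective : Injective _≡_ _≡_ v) (twins : ∀ i j → Twins G (v i) (v j))
         (first-switched : switchSign t (v Fin.zero) ≡ - 1ℚ)
         (last-unswitched : switchSign t (v (fromℕ (suc m))) ≡ 1ℚ) where

  v-≢ : ∀ {i j} → i ≢ j → v i ≢ v j
  v-≢ i≢j = i≢j ∘ v-injective

  pairFor : Fin (suc m) → Bool → Fin (suc (suc m)) × Fin (suc (suc m))
  pairFor k true  = Fin.suc k , fromℕ (suc m)
  pairFor k false = Fin.zero  , Fin.suc k

  SwitchedFirst : Fin (suc (suc m)) × Fin (suc (suc m)) → Set
  SwitchedFirst (i , j) = switchSign t (v i) ≡ - 1ℚ × switchSign t (v j) ≡ 1ℚ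

  pairFor-switchedFirst : ∀ k b → (toℕ (v (Fin.suc k)) <ᵇ t) ≡ b → SwitchedFirst (pairFor k b)
  pairFor-switchedFirst k true  sign = cong (if_then - 1ℚ else 1ℚ) sign , last-unswitched
  pairFor-switchedFirst k false sign = first-switched , cong (if_then - 1ℚ else 1ℚ) sign

  twinPair : Fin (suc m) → Fin (suc (suc m)) × Fin (suc (suc m))
  twinPair k = pairFor k (toℕ (v (Fin.suc k)) <ᵇ t)

  pairVector : Fin (suc (suc m)) × Fin (suc (suc m)) → Fin n → ℚ
  pairVector (i , j) = twinVector (v i) (v j)

  pairVector-eigenvector : ∀ p → SwitchedFirst p →
    IsEigenvector (switchedAdj G t) (- 1ℚ) (pairVector p) × IsMain (pairVector p)
  pairVector-eigenvector (i , j) (si , sj) =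
    twinVector-eigenvector G t (twins i j) si sj , twinVector-main (v i) (v j)

  switchedFirst⇒≢ : ∀ {i j} → SwitchedFirst (i , j) → v i ≢ v j
  switchedFirst⇒≢ (si , sj) = oppositeSigns⇒≢ t si sj

  pairFor-pivot : ∀ k b → (toℕ (v (Fin.suc k)) <ᵇ t) ≡ b →
    pairVector (pairFor k b) (v (Fin.suc k)) ≡ 1ℚ
  pairFor-pivot k true  sign = twinVector-fst (switchedFirst⇒≢ (pairFor-switchedFirst k true sign))
  pairFor-pivot k false sign = twinVector-snd (switchedFirst⇒≢ (pairFor-switchedFirst k false sign))

  pairFor-upper : ∀ {i} j b → i <ᶠ j → pairVector (pairFor j b) (v (Fin.suc i)) ≡ 0ℚ
  pairFor-upper j true  i<j =
    twinVector-outside (v-≢ (<⇒≢ i<j ∘ sym ∘ suc-injective)) (v-≢ (fromℕ≢-below i<j ∘ suc-injective))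
  pairFor-upper j false i<j =
    twinVector-outside (v-≢ λ ()) (v-≢ (<⇒≢ i<j ∘ sym ∘ suc-injective))

  eigenvectors : Fin (suc m) → Fin n → ℚ
  eigenvectors = pairVector ∘ twinPair

  independentMainEigenvectors : Σ (Fin (suc m) → Fin n → ℚ) (λ x →
      (∀ k → IsEigenvector (switchedAdj G t) (- 1ℚ) (x k) × IsMain (x k))
      × LinearlyIndependent x)
  independentMainEigenvectors =
    eigenvectors ,
    (λ k → pairVector-eigenvector (twinPair k) (pairFor-switchedFirst k _ refl)) ,
    unitriangular⇒linearlyIndependent eigenvectors (v ∘ Fin.suc)
      (λ k → pairFor-pivot k _ refl) (λ {_} {j} → pairFor-upper j (toℕ (v (Fin.suc j)) <ᵇ t))

<ᵇ≡false : ∀ {m n} → n ≤ m → (m <ᵇ n) ≡ false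
<ᵇ≡false {m} {n} n≤m with m <ᵇ n in m<ᵇn
... | false = refl
... | true  = contradiction (<ᵇ⇒< m n (subst T (sym m<ᵇn) tt)) (≤⇒≯ n≤m)

switchSign-inject≤ : ∀ {r n} (t : ℕ) (i : Fin r) (r≤n : r ≤ n) →
  switchSign t (inject≤ i r≤n) ≡ (if toℕ i <ᵇ t then - 1ℚ else 1ℚ)
switchSign-inject≤ t i r≤n = cong (λ k → if k <ᵇ t then - 1ℚ else 1ℚ) (toℕ-inject≤ i r≤n)

lemma2p2 : (n r t : ℕ) (G : Graph n) (r≤n : r ≤ n) → 2 ≤ r →
    (∀ (i j : Fin r) (w : Fin n) →
      closedNbhd G (inject≤ i r≤n) w ≡ closedNbhd G (inject≤ j r≤n) w) →
    1 ≤ t → t ≤ r ∸ 1 →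
    Σ (Fin (r ∸ 1) → Fin n → ℚ) (λ x →
      (∀ i → IsEigenvector (switchedAdj G t) (- 1ℚ) (x i) × IsMain (x i))
      × LinearlyIndependent x)
lemma2p2 n (suc (suc m)) t@(suc _) G r≤n _ twins _ t≤r-1 =
  TwinClass.independentMainEigenvectors G t (λ i → inject≤ i r≤n) (inject≤-injective r≤n r≤n _ _)
    twins (switchSign-inject≤ t Fin.zero r≤n) last-unswitched
  where
  last-unswitched : switchSign t (inject≤ (fromℕ (suc m)) r≤n) ≡ 1ℚ
  last-unswitched = trans (switchSign-inject≤ t (fromℕ (suc m)) r≤n)
    (cong (if_then - 1ℚ else 1ℚ) (trans (cong (_<ᵇ t) (toℕ-fromℕ (suc m))) (<ᵇ≡false t≤r-1)))
lemma2p2 n zero          t    G r≤n ()       _ _  _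
lemma2p2 n (suc zero)    t    G r≤n (s≤s ()) _ _  _
lemma2p2 n (suc (suc m)) zero G r≤n _        _ () _
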